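{- Let $\mathcal{X}$ be a connected $n$-premaniplex with base flag $x_0$, $N=\mathrm{Stab}_{\mathcal{C}^n}(x_0)$, and let $(\mathcal{Y},\eta)$ be an $(n,m)$-voltage operator that preserves connectivity, with base flag $y_0$ of $\mathcal{Y}$, $L=\mathrm{Stab}_{\mathcal{C}^m}(y_0)$, $\zeta:L\to\mathcal{C}^n$, $\zeta(\omega)=\eta(P_\omega(y_0))$, and $\mathcal{Z}_\upsilon=\mathcal{C}^n/\zeta(L\cap L^\upsilon)$ for $\upsilon\in\mathcal{C}^m$. Then the number of distinct premaniplexes $\mathcal{Z}_\upsilon$, $\upsilon\in\mathcal{C}^m$ (i.e. of distinct subgroups $\zeta(L\cap L^\upsilon)$), is at most the number of orbits of $\mathrm{Aut}(\mathcal{Y})$ on the flags of $\mathcal{Y}$.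
   Context: A graph may have multiple edges and semi-edges. An $n$-premaniplex is such a graph with edges coloured by $\{0,\dots,n-1\}$ so that every vertex (flag) is the starting point of exactly one dart of each colour, and whenever $|i-j|\ge2$ every alternating path of length 4 with colours $i,j$ is closed; $x^i$ is the end of the $i$-dart at $x$. $\mathcal{C}^n=\langle r_0,\dots,r_{n-1}\mid r_i^2=1,\ (r_ir_j)^2=1\ (|i-j|\ge2)\rangle$ acts on the left on flags by $r_ix=x^i$; $\mathrm{Stab}$ denotes stabilisers and $H^\upsilon=\upsilon^{ -1}H\upsilon$. Automorphisms are bijections of flags preserving all $i$-adjacencies. For $K\le\mathcal{C}^n$ the coset premaniplex $\mathcal{C}^n/K$ has flags the left cosets $\omega K$ with $i$-adjacency $\omega K\mapsto r_i\omega K$. For a flag $y$ of an $m$-premaniplex $\mathcal{Y}$ and $\omega\in\mathcal{C}^m$, $P_\omega(y)$ is the homotopy class of paths from $y$ whose successive colours $i_1,\dots,i_k$ satisfy $r_{i_k}\cdots r_{i_1}=\omega$ (homotopic iff same start and same element of $\mathcal{C}^m$); these form the fundamental groupoid $\Pi(\mathcal{Y})$. A voltage assignment $\eta:\Pi(\mathcal{Y})\to\mathcal{C}^n$ satisfies $\eta(W_1W_2)=\eta(W_2)\eta(W_1)$; $(\mathcal{Y},\eta)$ is an $(n,m)$-voltage operator; $\zeta$ is then a group homomorphism. $\mathcal{X}\rtimes_\eta\mathcal{Y}$ is the $m$-premaniplex with flags $\mathcal{X}\times\mathcal{Y}$ and $(x,y)^i=(\eta(P_{r_i}(y))x,y^i)$.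 The operator preserves connectivity if $\mathcal{X}'\rtimes_\eta\mathcal{Y}$ is connected for every connected $n$-premaniplex $\mathcal{X}'$. Standing assumption: $\mathcal{Y}$ has a spanning tree all of whose darts have trivial voltage. -}

module Defs where

open import Data.Nat using (ℕ; zero; suc; _<_)
open import Data.Fin using (Fin; toℕ)
open import Data.List using (List; []; _∷_; _++_; reverse)
open import Data.Product using (Σ; Σ-syntax; _×_; _,_; ∃; ∃-syntax)
open import Data.Sum using (_⊎_)
open import Relation.Binary.PropositionalEquality using (_≡_)

-- The group C^n, presented by words in the generators r_0,…,r_{n-1}
-- modulo the congruence generated by r_i^2 = 1 and (r_i r_j)^2 = 1
-- for |i - j| ≥ 2.  A word (i₁ ∷ … ∷ iₖ ∷ []) stands for r_{i₁}⋯r_{iₖ};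
-- multiplication is _++_, identity is [], inverse is reverse.

Word : ℕ → Set
Word n = List (Fin n)

Far : ∀ {n} → Fin n → Fin n → Set
Far i j = suc (toℕ i) < toℕ j ⊎ suc (toℕ j) < toℕ i

infix 4 _≈C_
data _≈C_ {n : ℕ} : Word n → Word n → Set where
  ≈-refl  : ∀ {u} → u ≈C u
  ≈-sym   : ∀ {u v} → u ≈C v → v ≈C u
  ≈-trans : ∀ {u v w} → u ≈C v → v ≈C w → u ≈C w
  ≈-cong  : ∀ {u u' v v'} → u ≈C u' → v ≈C v' → (u ++ v) ≈C (u' ++ v')
  ≈-inv   : ∀ i → (i ∷ i ∷ []) ≈C []
  ≈-far   : ∀ i j → Far i j → (i ∷ j ∷ i ∷ j ∷ []) ≈C []

-- Edge-coloured graphs given by "i-adjacency" maps, and the left action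
-- of words on their vertices: r_i x = x^i.

act : ∀ {k} {F : Set} → (Fin k → F → F) → Word k → F → F
act adj []      x = x
act adj (i ∷ w) x = adj i (act adj w x)

ConnectedG : ∀ {k} {F : Set} → (Fin k → F → F) → Set
ConnectedG {k} {F} adj = ∀ (a b : F) → ∃[ w ] (act adj w a ≡ b)

-- n-premaniplexes (semi-edges = fixed points, multi-edges allowed)

record Premaniplex (n : ℕ) : Set₁ where
  field
    Flag      : Set
    adj       : Fin n → Flag → Flag
    adj-invol : ∀ i x → adj i (adj i x) ≡ x
    adj-far   : ∀ i j → Far i j → ∀ x → adj i (adj j (adj i (adj j x))) ≡ x

open Premaniplex public

Connected : ∀ {n} → Premaniplex n → Set
Connected X = ConnectedG (adj X)

_·_ : ∀ {n} {X : Premaniplex n} → Word n → Flag X → Flag X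
_·_ {X = X} w x = act (adj X) w x

InStab : ∀ {n} (X : Premaniplex n) → Flag X → Word n → Set
InStab X x ω = act (adj X) ω x ≡ x

-- ω ∈ H^υ = υ⁻¹ H υ  iff  υ ω υ⁻¹ ∈ H
InConj : ∀ {n} → (Word n → Set) → Word n → Word n → Set
InConj H υ ω = H (υ ++ ω ++ reverse υ)

record Aut {n} (X : Premaniplex n) : Set where
  field
    fun     : Flag X → Flag X
    inv     : Flag X → Flag X
    inv-l   : ∀ x → inv (fun x) ≡ x
    inv-r   : ∀ x → fun (inv x) ≡ x
    fun-adj : ∀ i x → fun (adj X i x) ≡ adj X i (fun x)

SameOrbit : ∀ {n} (X : Premaniplex n) → Flag X → Flag X → Set
SameOrbit X x x' = Σ[ α ∈ Aut X ] (Aut.fun α x ≡ x')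

-- A homotopy class P_ω(y) of paths is
-- determined by its start y and ω ∈ C^m, so Π(Y) ≅ Flag Y × C^m and a
-- voltage assignment is η : Flag Y → Word m → Word n respecting ≈C in
-- ω, with η(W₁W₂) = η(W₂)η(W₁), where W₁ = P_{ω₁}(y),
-- W₂ = P_{ω₂}(ω₁ y), W₁W₂ = P_{ω₂ω₁}(y).

record VoltageOp (n m : ℕ) : Set₁ where
  field
    Y     : Premaniplex m
    η     : Flag Y → Word m → Word n
    η-resp : ∀ y {ω ω'} → ω ≈C ω' → η y ω ≈C η y ω'
    η-comp : ∀ y ω₁ ω₂ →
             η y (ω₂ ++ ω₁) ≈C (η (act (adj Y) ω₁ y) ω₂ ++ η y ω₁)

open VoltageOp public

-- Standing assumption: a spanning tree of Y all of whose darts have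
-- trivial voltage.  A spanning tree is given in rooted form: a root,
-- a depth function and for each non-root flag y a parent colour p y,
-- the tree edge being y — y^{p y}, with the depth strictly decreasing.
record TrivialSpanningTree {n m} (V : VoltageOp n m) : Set where
  field
    root      : Flag (Y V)
    depth     : Flag (Y V) → ℕ
    parent    : Flag (Y V) → Fin m
    depth-root : depth root ≡ 0
    depth-zero : ∀ y → depth y ≡ 0 → y ≡ root
    depth-dec  : ∀ y → 0 < depth y → depth (adj (Y V) (parent y) y) < depth y
    trivial    : ∀ y → 0 < depth y → η V y (parent y ∷ []) ≈C []

-- The i-adjacency of X ⋊_η Y : (x,y)^i = (η(P_{r_i}(y)) x, y^i)
sdpAdj : ∀ {n m} (X : Premaniplex n) (V : VoltageOp n m) →
         Fin m → Flag X × Flag (Y V) → Flag X × Flag (Y V)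
sdpAdj X V i (x , y) = act (adj X) (η V y (i ∷ [])) x , adj (Y V) i y

PreservesConnectivity : ∀ {n m} → VoltageOp n m → Set₁
PreservesConnectivity {n} V =
  ∀ (X' : Premaniplex n) → Connected X' → ConnectedG (sdpAdj X' V)

-- ζ(L ∩ L^υ) ≤ C^n as a predicate, L = Stab_{C^m}(y₀), ζ(ω) = η(P_ω(y₀))

ZetaSub : ∀ {n m} (V : VoltageOp n m) → Flag (Y V) → Word m → Word n → Set
ZetaSub V y₀ υ g =
  Σ[ ω ∈ Word _ ] (InStab (Y V) y₀ ω × InConj (InStab (Y V) y₀) υ ω × η V y₀ ω ≈C g)

SameSubset : ∀ {n} → (Word n → Set) → (Word n → Set) → Set
SameSubset A B = ∀ g → (A g → B g) × (B g → A g)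

-- ζ(L ∩ L^υ) only depends on the flag υ⁻¹y₀, since L^υ = Stab(υ⁻¹y₀): it is ζ(L ∩ Stab y)
-- for y = υ⁻¹y₀.  Applying the hypothesis to the one-flag premaniplex shows that Y is
-- connected, so every flag y arises as some υ_y⁻¹y₀, and automorphisms preserve
-- stabilisers, so ζ(L ∩ Stab y) is constant on Aut(Y)-orbits.
module Submission where

open import Defs
open import Data.Nat using (ℕ)
open import Data.Product using (Σ-syntax; _×_; ∃-syntax; _,_; proj₁; proj₂)
open import Data.Fin using (Fin)
open import Data.Unit using (⊤; tt)
open import Data.List using ([]; _∷_; _++_; reverse)
open import Data.List.Properties using (unfold-reverse; reverse-involutive)
open import Function.Bundles using (_⇔_; mk⇔; Equivalence)
open import Relation.Binary.PropositionalEquality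
open ≡-Reasoning

module _ {k : ℕ} {F : Set} (ad : Fin k → F → F) where

  act-++ : ∀ u v x → act ad (u ++ v) x ≡ act ad u (act ad v x)
  act-++ []      v x = refl
  act-++ (i ∷ u) v x = cong (ad i) (act-++ u v x)

  module _ (ad-invol : ∀ i x → ad i (ad i x) ≡ x) where

    act-reverse-act : ∀ u x → act ad (reverse u) (act ad u x) ≡ x
    act-reverse-act []      x = refl
    act-reverse-act (i ∷ u) x = begin
      act ad (reverse (i ∷ u)) (ad i (act ad u x))
        ≡⟨ cong (λ w → act ad w (ad i (act ad u x))) (unfold-reverse i u) ⟩
      act ad (reverse u ++ i ∷ []) (ad i (act ad u x))
        ≡⟨ act-++ (reverse u) (i ∷ []) _ ⟩
      act ad (reverse u) (ad i (ad i (act ad u x)))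
        ≡⟨ cong (act ad (reverse u)) (ad-invol i _) ⟩
      act ad (reverse u) (act ad u x)
        ≡⟨ act-reverse-act u x ⟩
      x ∎

    act-act-reverse : ∀ u x → act ad u (act ad (reverse u) x) ≡ x
    act-act-reverse u x = begin
      act ad u (act ad (reverse u) x)
        ≡⟨ cong (λ w → act ad w (act ad (reverse u) x)) (sym (reverse-involutive u)) ⟩
      act ad (reverse (reverse u)) (act ad (reverse u) x)
        ≡⟨ act-reverse-act (reverse u) x ⟩
      x ∎

    act-transpose : ∀ u x z → act ad u z ≡ x ⇔ z ≡ act ad (reverse u) x
    act-transpose u x z = mk⇔
      (λ e → trans (sym (act-reverse-act u z)) (cong (act ad (reverse u)) e))
      (λ e → trans (cong (act ad u) e) (act-act-reverse u x))

module _ {n : ℕ} (X : Premaniplex n) where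

  inConj-inStab⇔inStab-reverse : ∀ x υ ω →
    InConj (InStab X x) υ ω ⇔ InStab X (act (adj X) (reverse υ) x) ω
  inConj-inStab⇔inStab-reverse x υ ω = mk⇔
    (λ e → Equivalence.to (transpose (act (adj X) ω x')) (trans (sym unfold) e))
    (λ e → trans unfold (Equivalence.from (transpose (act (adj X) ω x')) e))
    where
      x' = act (adj X) (reverse υ) x
      transpose = act-transpose (adj X) (adj-invol X) υ x
      unfold : act (adj X) (υ ++ ω ++ reverse υ) x ≡ act (adj X) υ (act (adj X) ω x')
      unfold = trans (act-++ (adj X) υ (ω ++ reverse υ) x)
                     (cong (act (adj X) υ) (act-++ (adj X) ω (reverse υ) x))

  aut-act : (α : Aut X) → ∀ ω x → Aut.fun α (act (adj X) ω x) ≡ act (adj X) ω (Aut.fun α x)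
  aut-act α []      x = refl
  aut-act α (i ∷ ω) x = trans (Aut.fun-adj α i _) (cong (adj X i) (aut-act α ω x))

  sameOrbit⇒inStab⇔ : ∀ {x x'} → SameOrbit X x x' → ∀ ω → InStab X x ω ⇔ InStab X x' ω
  sameOrbit⇒inStab⇔ {x} (α , refl) ω = mk⇔
    (λ e → trans (sym (aut-act α ω x)) (cong (Aut.fun α) e))
    (λ e → begin
      act (adj X) ω x                           ≡⟨ sym (Aut.inv-l α _) ⟩
      Aut.inv α (Aut.fun α (act (adj X) ω x))   ≡⟨ cong (Aut.inv α) (aut-act α ω x) ⟩
      Aut.inv α (act (adj X) ω (Aut.fun α x))   ≡⟨ cong (Aut.inv α) e ⟩
      Aut.inv α (Aut.fun α x)                   ≡⟨ Aut.inv-l α x ⟩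
      x                                         ∎)

point : (n : ℕ) → Premaniplex n
point n = record
  { Flag = ⊤ ; adj = λ _ _ → tt ; adj-invol = λ _ _ → refl ; adj-far = λ _ _ _ _ → refl }

module _ {n m : ℕ} (V : VoltageOp n m) where

  sdpAdj-act-proj₂ : (X : Premaniplex n) → ∀ w (p : Flag X × Flag (Y V)) →
    proj₂ (act (sdpAdj X V) w p) ≡ act (adj (Y V)) w (proj₂ p)
  sdpAdj-act-proj₂ X []      p = refl
  sdpAdj-act-proj₂ X (i ∷ w) p = cong (adj (Y V) i) (sdpAdj-act-proj₂ X w p)

  preservesConnectivity⇒connected : PreservesConnectivity V → Connected (Y V)
  preservesConnectivity⇒connected pc y y' =
    let w , e = pc (point n) (λ _ _ → [] , refl) (tt , y) (tt , y')
    in w , trans (sym (sdpAdj-act-proj₂ (point n) w (tt , y))) (cong proj₂ e)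

  ZetaImage : Flag (Y V) → (Word m → Set) → Word n → Set
  ZetaImage y₀ P g = Σ[ ω ∈ Word m ] (InStab (Y V) y₀ ω × P ω × η V y₀ ω ≈C g)

  zetaImage-cong : ∀ y₀ {P Q : Word m → Set} → (∀ ω → P ω ⇔ Q ω) →
    SameSubset (ZetaImage y₀ P) (ZetaImage y₀ Q)
  zetaImage-cong y₀ P⇔Q g =
      (λ (ω , s , p , e) → ω , s , Equivalence.to (P⇔Q ω) p , e)
    , (λ (ω , s , q , e) → ω , s , Equivalence.from (P⇔Q ω) q , e)

  zetaSub≈zetaImage-inStab : ∀ y₀ υ →
    SameSubset (ZetaSub V y₀ υ) (ZetaImage y₀ (InStab (Y V) (act (adj (Y V)) (reverse υ) y₀)))
  zetaSub≈zetaImage-inStab y₀ υ = zetaImage-cong y₀ (inConj-inStab⇔inStab-reverse (Y V) y₀ υ)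

module _ {n : ℕ} where

  sameSubset-sym : {A B : Word n → Set} → SameSubset A B → SameSubset B A
  sameSubset-sym A≈B g = proj₂ (A≈B g) , proj₁ (A≈B g)

  sameSubset-trans : {A B C : Word n → Set} → SameSubset A B → SameSubset B C → SameSubset A C
  sameSubset-trans A≈B B≈C g =
      (λ a → proj₁ (B≈C g) (proj₁ (A≈B g) a))
    , (λ c → proj₂ (A≈B g) (proj₂ (B≈C g) c))

lemma5p8 : ∀ {n m : ℕ} (X : Premaniplex n) (x₀ : Flag X) → Connected X →
           (V : VoltageOp n m) → TrivialSpanningTree V →
           PreservesConnectivity V → (y₀ : Flag (Y V)) →
           Σ[ f ∈ (Flag (Y V) → Word m) ]
             ((∀ (υ : Word m) → ∃[ y ] SameSubset (ZetaSub V y₀ (f y)) (ZetaSub V y₀ υ))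
             × (∀ y y' → SameOrbit (Y V) y y' →
                  SameSubset (ZetaSub V y₀ (f y)) (ZetaSub V y₀ (f y'))))
lemma5p8 _ _ _ V _ pc y₀ = f , realises , orbit-invariant
  where
    path : ∀ y → ∃[ w ] (act (adj (Y V)) w y₀ ≡ y)
    path = preservesConnectivity⇒connected V pc y₀

    f : Flag (Y V) → Word _
    f y = reverse (proj₁ (path y))

    f-reaches : ∀ y → act (adj (Y V)) (reverse (f y)) y₀ ≡ y
    f-reaches y = trans (cong (λ w → act (adj (Y V)) w y₀) (reverse-involutive (proj₁ (path y))))
                        (proj₂ (path y))

    zetaSub-f : ∀ y → SameSubset (ZetaSub V y₀ (f y)) (ZetaImage V y₀ (InStab (Y V) y))
    zetaSub-f y = subst (λ z → SameSubset (ZetaSub V y₀ (f y)) (ZetaImage V y₀ (InStab (Y V) z)))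
                        (f-reaches y) (zetaSub≈zetaImage-inStab V y₀ (f y))

    realises : ∀ υ → ∃[ y ] SameSubset (ZetaSub V y₀ (f y)) (ZetaSub V y₀ υ)
    realises υ = _ , sameSubset-trans (zetaSub-f _) (sameSubset-sym (zetaSub≈zetaImage-inStab V y₀ υ))

    orbit-invariant : ∀ y y' → SameOrbit (Y V) y y' →
                      SameSubset (ZetaSub V y₀ (f y)) (ZetaSub V y₀ (f y'))
    orbit-invariant y y' o =
      sameSubset-trans (zetaSub-f y)
        (sameSubset-trans (zetaImage-cong V y₀ (sameOrbit⇒inStab⇔ (Y V) o))
                          (sameSubset-sym (zetaSub-f y')))
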